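{- Let $\mu:G\times H\to K$ be a graph homomorphism, where $K$ is square-free, $G$ and $H$ are connected, and $G$ is non-bipartite. If $\mu$ has no $H$-extremal sets and is constant on $V(G)\times\{h\}$ for some $h\in V(H)$, then $\mu=\gamma\circ\delta$, where $\delta:G\times H\to H$ is the projection to $H$ and $\gamma:H\to K$ is a graph homomorphism.
   Context: All graphs are finite, simple, loopless; every graph has at least two vertices and no isolated vertices. $G\times H$ is the tensor product (vertices $V(G)\times V(H)$, $(g,h)(g',h')$ an edge iff $gg'\in E(G)$ and $hh'\in E(H)$); $G\times h_0h_1$ is the subgraph induced by $V(G)\times\{h_0,h_1\}$. Square-free: no four pairwise distinct vertices $v_1,\dots,v_4$ with $v_1v_2,v_2v_3,v_3v_4,v_4v_1$ edges. $N_F(S)$ is the set of neighbors of vertices of $S$ in $F$, $N^2_F(S)=N_F(N_F(S))\setminus S$. An $H$-extremal set for $\mu$ is a pair $(S,h_0h_1)$ with $h_0h_1$ an oriented edge of $H$ and $S\subseteq V(G)\times\{h_1\}$ such that for some $a,b\in V(K)$: $\mu(S)=\{a\}$, $\mu(N_{G\times h_0h_1}(S))=\{b\}$, $N^2_{G\times h_0h_1}(S)\ne\emptyset$, and $a\notin\mu(N^2_{G\times h_0h_1}(S))$. -}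

module Defs where

open import Data.Nat using (ℕ; _≤_)
open import Data.Fin using (Fin)
open import Data.Bool using (Bool; true; false; T)
open import Data.Product using (Σ; ∃; ∃-syntax; _×_; _,_)
open import Relation.Binary.PropositionalEquality using (_≡_; _≢_)
open import Relation.Nullary using (¬_)

record Graph : Set where
  field
    n          : ℕ
    adj        : Fin n → Fin n → Bool
    adj-sym    : ∀ u v → adj u v ≡ adj v u
    adj-irrefl : ∀ v → adj v v ≡ false
    two≤n      : 2 ≤ n
    no-isolated : ∀ v → ∃[ w ] T (adj v w)

open Graph public

V : Graph → Set
V G = Fin (n G)

E : (G : Graph) → V G → V G → Set
E G u v = T (adj G u v)

record Hom (G K : Graph) : Set where
  field
    fun  : V G → V K
    pres : ∀ {u v} → E G u v → E K (fun u) (fun v)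

open Hom public

TensorE : (G H : Graph) → V G × V H → V G × V H → Set
TensorE G H (g , h) (g' , h') = E G g g' × E H h h'

record TensorHom (G H K : Graph) : Set where
  field
    tfun  : V G × V H → V K
    tpres : ∀ {x y} → TensorE G H x y → E K (tfun x) (tfun y)

open TensorHom public

data Walk (G : Graph) : V G → V G → Set where
  [] : ∀ {v} → Walk G v v
  _∷_ : ∀ {u v w} → E G u v → Walk G v w → Walk G u w

Connected : Graph → Set
Connected G = ∀ u v → Walk G u v

Bipartite : Graph → Set
Bipartite G = Σ (V G → Bool) λ c → ∀ u v → E G u v → c u ≢ c v

SquareFree : Graph → Set
SquareFree K =
  ∀ (v₁ v₂ v₃ v₄ : V K) →
    v₁ ≢ v₂ → v₁ ≢ v₃ → v₁ ≢ v₄ → v₂ ≢ v₃ → v₂ ≢ v₄ → v₃ ≢ v₄ →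
    ¬ (E K v₁ v₂ × E K v₂ v₃ × E K v₃ v₄ × E K v₄ v₁)

-- A subset S ⊆ V(G) × {h₁} is represented by its characteristic function on V(G).
-- In G × h₀h₁ (h₀h₁ an edge, so h₀ ≠ h₁), N(S) lies in the layer V(G) × {h₀}:
-- (g , h₀) ∈ N(S)  iff  some s ∈ S is G-adjacent to g.
InN : (G : Graph) → (V G → Bool) → V G → Set
InN G S g = ∃[ s ] (T (S s) × E G s g)

-- N²(S) = N(N(S)) \ S, lying in the layer V(G) × {h₁}.
InN2 : (G : Graph) → (V G → Bool) → V G → Set
InN2 G S g = (∃[ g' ] (InN G S g' × E G g' g)) × S g ≡ false

IsExtremal : {G H K : Graph} → TensorHom G H K →
             (V G → Bool) → (h₀ h₁ : V H) → Set
IsExtremal {G} {H} {K} μ S h₀ h₁ =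
  E H h₀ h₁ ×
  Σ (V K) λ a → Σ (V K) λ b →
    ((∃[ g ] T (S g)) × (∀ g → T (S g) → tfun μ (g , h₁) ≡ a)) ×
    ((∃[ g ] InN G S g) × (∀ g → InN G S g → tfun μ (g , h₀) ≡ b)) ×
    (∃[ g ] InN2 G S g) ×
    (∀ g → InN2 G S g → tfun μ (g , h₁) ≢ a)

NoExtremalSets : {G H K : Graph} → TensorHom G H K → Set
NoExtremalSets {G} {H} μ = ∀ (S : V G → Bool) (h₀ h₁ : V H) → ¬ IsExtremal μ S h₀ h₁

module Submission where

-- Call a layer V(G) × {h} of G × H constant if μ takes a single
-- value on it.  The theorem follows once every layer is constant: then
-- γ(h) := μ(g₀ , h) for any fixed g₀ is a homomorphism H → K with μ = γ ∘ δ.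
-- Since H is connected, it suffices that constancy passes across an edge h₀h₁.
-- Suppose the layer at h₀ is constant with value b, and let S be the level set
-- {g | μ(g , h₁) = a} of the layer at h₁.  Then μ(S) = {a} and μ(N(S)) = {b},
-- so the absence of H-extremal sets forces N²(S) ⊆ S: the set S is closed
-- under walks of length two in G.  A purely graph-theoretic lemma finishes the
-- step: in a connected non-bipartite graph, a nonempty subset closed under
-- two-step walks is the whole vertex set (otherwise S itself would be a proper
-- 2-colouring).

open import Defs
open import Data.Bool using (Bool; true; false; T)
open import Data.Bool.Properties using (T-≡; T-not-≡)
open import Data.Empty using (⊥)
open import Data.Fin using (zero) renaming (_≟_ to _≟ᶠ_)
open import Data.Nat using (s≤s)
open import Data.Product using (Σ; ∃; ∃-syntax; _×_; _,_; proj₁)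
open import Data.Sum using (_⊎_; inj₁; inj₂)
open import Function.Bundles using (Equivalence)
open import Relation.Binary.PropositionalEquality using (_≡_; _≢_; refl; sym; trans; subst)
open import Relation.Nullary using (¬_; yes; no; isYes)
open import Relation.Nullary.Decidable using (toWitness; fromWitness; fromWitnessFalse)

open Equivalence using (to; from)

E-sym : (G : Graph) {u v : V G} → E G u v → E G v u
E-sym G {u} {v} = subst T (adj-sym G u v)

someVertex : (G : Graph) → V G
someVertex G with n G | two≤n G
... | _ | s≤s _ = zero

TwoStepClosed : (G : Graph) → (V G → Bool) → Set
TwoStepClosed G S = ∀ {s u w} → T (S s) → E G s u → E G u w → T (S w)

module TwoStepClosedSet (G : Graph) (S : V G → Bool) (closed : TwoStepClosed G S) where

  InClosure : V G → Set
  InClosure x = T (S x) ⊎ InN G S x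

  -- Membership in S ∪ N(S) survives a walk: a step from S lands in N(S),
  -- and a step from N(S) lands in S by two-step closedness.
  closure-along-walk : ∀ {x y} → InClosure x → Walk G x y → InClosure y
  closure-along-walk p [] = p
  closure-along-walk {x} (inj₁ x∈S) (e ∷ w) =
    closure-along-walk (inj₂ (x , x∈S , e)) w
  closure-along-walk (inj₂ (s , s∈S , es)) (e ∷ w) =
    closure-along-walk (inj₁ (closed s∈S es e)) w

  InsideS : V G → Set
  InsideS x = T (S x) × InN G S x

  -- Being inside S survives a walk: if x ∈ S has an S-neighbour z and x — y,
  -- then y ∈ S (walk z — x — y) and x is an S-neighbour of y.
  inside-along-walk : ∀ {x y} → InsideS x → Walk G x y → InsideS y
  inside-along-walk p [] = p
  inside-along-walk {x} (x∈S , z , z∈S , ez) (e ∷ w) =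
    inside-along-walk (closed z∈S ez e , x , x∈S , e) w

  -- In a connected non-bipartite graph a nonempty two-step-closed set is
  -- everything: if v ∉ S, then S is a proper 2-colouring of G.
  nonempty-is-everything : Connected G → ¬ Bipartite G →
                           ∀ {g₀} → T (S g₀) → ∀ v → T (S v)
  nonempty-is-everything conn nonBip {g₀} g₀∈S v with S v in v∉S
  ... | true  = _
  ... | false = nonBip (S , proper)
    where
    -- an edge inside S would spread S over all of G, reaching v
    noEdgeInside : ∀ {u w} → E G u w → T (S u) → T (S w) → ⊥
    noEdgeInside {u} {w} e u∈S w∈S =
      subst T v∉S (proj₁ (inside-along-walk (u∈S , w , w∈S , E-sym G e) (conn u v)))

    -- an edge outside S: u is adjacent to S (u ∈ S ∪ N(S) by connectivity),
    -- so its neighbour w is in S by two-step closedness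
    noEdgeOutside : ∀ {u w} → E G u w → ¬ (T (S u)) → ¬ (T (S w)) → ⊥
    noEdgeOutside {u} e u∉S w∉S with closure-along-walk (inj₁ g₀∈S) (conn g₀ u)
    ... | inj₁ u∈S           = u∉S u∈S
    ... | inj₂ (s , s∈S , es) = w∉S (closed s∈S es e)

    proper : ∀ u w → E G u w → S u ≢ S w
    proper u w e same with S u in su | S w in sw
    ... | true  | true  = noEdgeInside e (from T-≡ su) (from T-≡ sw)
    ... | false | false = noEdgeOutside e (subst T su) (subst T sw)
    proper u w e () | true  | false
    proper u w e () | false | true

ConstantLayer : {G H K : Graph} → TensorHom G H K → V H → Set
ConstantLayer {G} μ h = ∀ (g g' : V G) → tfun μ (g , h) ≡ tfun μ (g' , h)

module _ {G H K : Graph} (μ : TensorHom G H K) where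

  levelSet : V H → V K → V G → Bool
  levelSet h a g = isYes (tfun μ (g , h) ≟ᶠ a)

  -- Next to a constant layer, level sets are two-step closed: otherwise the
  -- level set S of the value a, with μ(S) = {a}, μ(N(S)) = {b} and a vertex
  -- of N²(S) outside S, would be an H-extremal set.
  levelSet-closed : NoExtremalSets μ → ∀ {h₀ h₁} → E H h₀ h₁ →
                    ConstantLayer μ h₀ → ∀ a → TwoStepClosed G (levelSet h₁ a)
  levelSet-closed noExtremal {h₀} {h₁} e constant a {s} {u} {w} s∈S es euw
    with tfun μ (w , h₁) ≟ᶠ a
  ... | yes _ = _
  ... | no w↦̸a = noExtremal (levelSet h₁ a) h₀ h₁
    ( e , a , tfun μ (u , h₀)
    , ((s , s∈S) , λ _ → toWitness)
    , ((u , s , s∈S , es) , λ x _ → constant x u)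
    , (w , (u , (s , s∈S , es) , euw) , to T-not-≡ (fromWitnessFalse w↦̸a))
    , λ x (_ , x∉S) x↦a → subst T x∉S (fromWitness x↦a) )

  -- Constancy of layers crosses every edge of H: the level set of the value
  -- μ(g , h₁) is nonempty and two-step closed, hence all of V(G).
  constancy-crosses-edge : Connected G → ¬ Bipartite G → NoExtremalSets μ →
                           ∀ {h₀ h₁} → E H h₀ h₁ →
                           ConstantLayer μ h₀ → ConstantLayer μ h₁
  constancy-crosses-edge conn nonBip noExtremal {h₁ = h₁} e constant g g' =
    sym (toWitness (nonempty-is-everything conn nonBip (fromWitness refl) g'))
    where
    open TwoStepClosedSet G (levelSet h₁ (tfun μ (g , h₁)))
                            (levelSet-closed noExtremal e constant _)

  constancy-along-walk : Connected G → ¬ Bipartite G → NoExtremalSets μ →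
                         ∀ {h h'} → Walk H h h' →
                         ConstantLayer μ h → ConstantLayer μ h'
  constancy-along-walk conn nonBip noExtremal []      constant = constant
  constancy-along-walk conn nonBip noExtremal (e ∷ w) constant =
    constancy-along-walk conn nonBip noExtremal w
      (constancy-crosses-edge conn nonBip noExtremal e constant)

  -- If every layer is constant, μ = γ ∘ δ with γ(h) = μ(g₀ , h); γ is a
  -- homomorphism because g₀ has a neighbour g₁ and μ(g₁ , v) = μ(g₀ , v).
  factor-through-projection : (∀ h → ConstantLayer μ h) →
    Σ (Hom H K) λ γ → ∀ (g : V G) (h : V H) → tfun μ (g , h) ≡ fun γ h
  factor-through-projection constant = γ , λ g h → constant h g g₀
    where
    g₀ : V G
    g₀ = someVertex G

    γ : Hom H K
    γ = record
      { fun  = λ h → tfun μ (g₀ , h)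
      ; pres = λ {u} {v} e →
          let (g₁ , e₀₁) = no-isolated G g₀
          in subst (E K (tfun μ (g₀ , u))) (constant v g₁ g₀) (tpres μ (e₀₁ , e))
      }

lemma17 : (G H K : Graph) (μ : TensorHom G H K) →
    SquareFree K → Connected G → Connected H → ¬ Bipartite G →
    NoExtremalSets μ →
    (∃[ h ] ∃[ c ] (∀ (g : V G) → tfun μ (g , h) ≡ c)) →
    Σ (Hom H K) λ γ → ∀ (g : V G) (h : V H) → tfun μ (g , h) ≡ fun γ h
lemma17 G H K μ _ connG connH nonBip noExtremal (h , c , μ≡c) =
  factor-through-projection μ everyLayerConstant
  where
  layer-h-constant : ConstantLayer μ h
  layer-h-constant g g' = trans (μ≡c g) (sym (μ≡c g'))

  everyLayerConstant : ∀ h' → ConstantLayer μ h'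
  everyLayerConstant h' =
    constancy-along-walk μ connG nonBip noExtremal (connH h h') layer-h-constant
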